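{- Let $m\ge3$ be an odd integer and let $\ell$ be a distance magic labeling of $C_m\square C_{2m}$ with $\ell_{0,0}=1$, and let $L$ be its $m\times 2m$ table. Then there exists an admissible pair $\langle\mathbf{a},\mathbf{b}\rangle$ such that $re(L)=\mathcal{T}(\mathbf{a},\frac{m-1}{2})+\mathcal{T}(\mathbf{b},\frac{m+1}{2})$ (equivalently, $L = ex\big(\mathcal{T}(\mathbf{a},\frac{m-1}{2})+\mathcal{T}(\mathbf{b},\frac{m+1}{2})\big)$). Moreover, this admissible pair of sequences is uniquely determined by $\ell$.
   Context: $\mathcal{N}_N=\{1-N,3-N,\ldots,N-1\}$. A distance magic labeling of a graph of order $N$ is a bijection $\ell:V\to\mathcal{N}_N$ such that every vertex has neighbour-label sum $0$. $C_m\square C_{2m}$ is the Cayley graph of $\mathbb{Z}_m\times\mathbb{Z}_{2m}$ with connection set $\{\pm(1,0),\pm(0,1)\}$; a labeling is represented by the $m\times 2m$ table $L=[\ell_{i,j}]$, $\ell_{i,j}=\ell((i,j))$, first index modulo $m$, second modulo $2m$. $re(L)$ is the $m\times m$ table $[t_{i,j}]$ with $t_{i,j}=\ell_{i,2j}$; for an $m\times m$ table $T$, $ex(T)$ is the $m\times 2m$ table with $(i,j)$ entry $t_{i,j/2}$ for $j$ even and $-t_{i,(j+m)/2}$ for $j$ odd. For a sequence $R=[r_0,\ldots,r_{m-1}]$ and $s\in\{0,\ldots,m-1\}$, $\mathcal{T}(R,s)$ is the $m\times m$ table with $(i,j)$ entry $r_{j-si}$ (index mod $m$); tables are added entrywise.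 A pair $\langle[a_0,\ldots,a_{m-1}],[b_0,\ldots,b_{m-1}]\rangle$ is admissible if all $a_i$ are odd integers in $\{1-2m^2,\ldots,2m^2-1\}$, all $b_i$ are even integers in $\{ -2m^2,\ldots,2m^2-2\}$, $a_0=1$, $b_0=0$, and $\{x(a_i+b_j):x\in\{ -1,1\},0\le i,j<m\}=\mathcal{N}_{2m^2}$. -}

module Defs where

open import Data.Nat as ℕ using (ℕ; zero; suc; NonZero; _∸_)
open import Data.Nat.DivMod using (_mod_; _/_)
open import Data.Fin using (Fin; toℕ)
open import Data.Integer as ℤ using (ℤ; +_)
open import Data.Product using (Σ; ∃; _×_; _,_)
open import Data.Sum using (_⊎_)
open import Relation.Binary.PropositionalEquality using (_≡_)

nz2 : (m : ℕ) → .{{NonZero m}} → NonZero (2 ℕ.* m)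
nz2 (suc m) = _

OddN : ℕ → Set
OddN m = Σ ℕ λ k → m ≡ suc (2 ℕ.* k)

Inℕ𝒩 : ℕ → ℤ → Set
Inℕ𝒩 N x = Σ (Fin N) λ k → x ≡ (+ (2 ℕ.* toℕ k ℕ.+ 1)) ℤ.- (+ N)

module _ (m : ℕ) .{{_ : NonZero m}} where

  ι₁ : ℕ → Fin m
  ι₁ x = x mod m

  ι₂ : ℕ → Fin (2 ℕ.* m)
  ι₂ x = _mod_ x (2 ℕ.* m) {{nz2 m}}

  Ord : ℕ
  Ord = m ℕ.* (2 ℕ.* m)

  -- labelings of V(C_m □ C_{2m}) = ℤ_m × ℤ_{2m}, given as the m × 2m table
  Labeling : Set
  Labeling = Fin m → Fin (2 ℕ.* m) → ℤ

  -- neighbour sum at (i,j): neighbours (i±1,j), (i,j±1)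
  nbrSum : Labeling → Fin m → Fin (2 ℕ.* m) → ℤ
  nbrSum ℓ i j =
    ℓ (ι₁ (suc (toℕ i))) j ℤ.+ ℓ (ι₁ (toℕ i ℕ.+ (m ∸ 1))) j
    ℤ.+ ℓ i (ι₂ (suc (toℕ j))) ℤ.+ ℓ i (ι₂ (toℕ j ℕ.+ (2 ℕ.* m ∸ 1)))

  -- distance magic labeling: bijection V → 𝒩_Ord with all neighbour sums 0
  IsDistanceMagic : Labeling → Set
  IsDistanceMagic ℓ =
    (∀ i j → Inℕ𝒩 Ord (ℓ i j))
    × (∀ i j i′ j′ → ℓ i j ≡ ℓ i′ j′ → (i ≡ i′ × j ≡ j′))
    × (∀ x → Inℕ𝒩 Ord x → Σ (Fin m) λ i → Σ (Fin (2 ℕ.* m)) λ j → ℓ i j ≡ x)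
    × (∀ i j → nbrSum ℓ i j ≡ + 0)

  Table : Set
  Table = Fin m → Fin m → ℤ

  Seq : Set
  Seq = Fin m → ℤ

  re : Labeling → Table
  re ℓ i j = ℓ i (ι₂ (2 ℕ.* toℕ j))

  -- 𝒯(R,s): (i,j) entry r_{j - s i mod m}   (for s ≤ m)
  𝒯 : Seq → ℕ → Table
  𝒯 R s i j = R (ι₁ ((toℕ j ℕ.+ m ℕ.* toℕ i) ∸ s ℕ.* toℕ i))

  _⊞_ : Table → Table → Table
  (T ⊞ U) i j = T i j ℤ.+ U i j

  OddZ : ℤ → Set
  OddZ x = Σ ℤ λ k → x ≡ + 1 ℤ.+ + 2 ℤ.* k

  EvenZ : ℤ → Set
  EvenZ x = Σ ℤ λ k → x ≡ + 2 ℤ.* k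

  Admissible : Seq → Seq → Set
  Admissible a b =
    (∀ i → OddZ (a i) × (+ 1 ℤ.- + (2 ℕ.* m ℕ.* m) ℤ.≤ a i) × (a i ℤ.≤ + (2 ℕ.* m ℕ.* m) ℤ.- + 1))
    × (∀ i → EvenZ (b i) × (ℤ.- + (2 ℕ.* m ℕ.* m) ℤ.≤ b i) × (b i ℤ.≤ + (2 ℕ.* m ℕ.* m) ℤ.- + 2))
    × (a (ι₁ 0) ≡ + 1)
    × (b (ι₁ 0) ≡ + 0)
    × (∀ y → (Σ ℤ λ x → (x ≡ + 1 ⊎ x ≡ ℤ.- + 1) × Σ (Fin m) λ i → Σ (Fin m) λ j → y ≡ x ℤ.* (a i ℤ.+ b j))
             → Inℕ𝒩 (2 ℕ.* m ℕ.* m) y)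
    × (∀ y → Inℕ𝒩 (2 ℕ.* m ℕ.* m) y
             → Σ ℤ λ x → (x ≡ + 1 ⊎ x ≡ ℤ.- + 1) × Σ (Fin m) λ i → Σ (Fin m) λ j → y ≡ x ℤ.* (a i ℤ.+ b j))

  Represents : Labeling → Seq → Seq → Set
  Represents ℓ a b = ∀ i j → re ℓ i j ≡ (𝒯 a ((m ∸ 1) / 2) ⊞ 𝒯 b ((m ℕ.+ 1) / 2)) i j

{-# OPTIONS --safe #-}
-- Write m = 2k + 1 and read ℓ as an array L on ℕ × ℕ.  The zero neighbour sums make
-- the diagonal sums L(x+1, y) + L(x, y+1) alternate in sign along the diagonal, so,
-- m being odd, they change sign under y ↦ y + m.  Hence s(x, y) = L(x, y) + L(x, y+m)
-- satisfies s(x+1, y) = −s(x, y+1); walking m rows down and 2km ≡ 0 columns across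
-- gives s = −s, i.e. L is antipodal: L(x, y+m) = −L(x, y).
-- In the coordinates P = j + (k+1)i, Q = j + ki of the entry (i, 2j), antipodality
-- turns the neighbour sum at (i, 2j+1) into the vanishing of the mixed difference of
-- F(P, Q) = L(i, 2j), so F(P, Q) = F(P, 0) + F(0, Q) − F(0, 0); this is the
-- representation with a_P = F(P, 0) and b_Q = F(0, Q) − 1.  The change of coordinates
-- is invertible mod m, so every representing pair with a₀ = 1, b₀ = 0 is read off F.
-- The sums a_P + b_Q are the labels in even columns and the labels in odd columns are
-- their negatives, which gives admissibility.
module Submission where

open import Defs
open import Data.Nat as ℕ using (ℕ; zero; suc; NonZero; _+_; _*_; _∸_; _%_; _/_; _≤_)
open import Data.Nat.DivMod using (_mod_; m≡m%n+[m/n]*n; [m+n]%n≡m%n; m<n⇒m%n≡m; m*n/n≡m)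
open import Data.Nat.Properties as ℕ using (+-identityʳ; +-comm; *-suc; m+[n∸m]≡n; m+n∸n≡m; m≤n+m)
open import Data.Fin using (Fin; toℕ; opposite)
open import Data.Fin.Properties using (toℕ-fromℕ<; fromℕ<-cong; fromℕ<-toℕ; toℕ<n; opposite-prop)
open import Data.Integer as ℤ using (ℤ; +_; _⊖_)
open import Data.Integer.Properties as ℤ
  using (neg-involutive; neg-mono-≤; neg-distrib-+; m-n≡m⊖n; ⊖-swap; +-cancelˡ-⊖; pos-+; pos-*; +-0-abelianGroup)
open import Algebra.Properties.AbelianGroup +-0-abelianGroup using (inverseʳ-unique)
import Data.Nat.Tactic.RingSolver as ℕ-Solver
import Data.Integer.Tactic.RingSolver as ℤ-Solver
open import Data.Product using (Σ; ∃; _×_; _,_)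
open import Data.Sum using (_⊎_; inj₁; inj₂)
open import Relation.Binary.PropositionalEquality
open ≡-Reasoning

Periodic : ∀ {a} {A : Set a} → ℕ → (ℕ → A) → Set a
Periodic n f = ∀ x → f (x + n) ≡ f x

module _ {a} {A : Set a} {n : ℕ} {f : ℕ → A} (f-periodic : Periodic n f) where

  periodic-+* : ∀ x c → f (x + c * n) ≡ f x
  periodic-+* x zero    = cong f (+-identityʳ x)
  periodic-+* x (suc c) = begin
    f (x + (n + c * n)) ≡⟨ cong f (rotate x n c) ⟩
    f (x + c * n + n)   ≡⟨ f-periodic (x + c * n) ⟩
    f (x + c * n)       ≡⟨ periodic-+* x c ⟩
    f x                 ∎
    where
    rotate : ∀ x n c → x + (n + c * n) ≡ x + c * n + n
    rotate = ℕ-Solver.solve-∀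

  periodic-shift : ∀ {x y} c → x ≡ y + c * n → f x ≡ f y
  periodic-shift {y = y} c refl = periodic-+* y c

  periodic-% : .{{_ : NonZero n}} → ∀ x → f (x % n) ≡ f x
  periodic-% x = sym (periodic-shift (x / n) (m≡m%n+[m/n]*n x n))

module _ (n : ℕ) .{{_ : NonZero n}} where

  mod-periodic : Periodic n (_mod n)
  mod-periodic x = fromℕ<-cong _ _ ([m+n]%n≡m%n x n) _ _

  toℕ-mod-invariant : ∀ {a} {A : Set a} {f : ℕ → A} → Periodic n f → ∀ x → f (toℕ (x mod n)) ≡ f x
  toℕ-mod-invariant {f = f} f-periodic x = trans (cong f (toℕ-fromℕ< _)) (periodic-% f-periodic x)

  mod-toℕ : ∀ (i : Fin n) → toℕ i mod n ≡ i
  mod-toℕ i = trans (fromℕ<-cong _ _ (m<n⇒m%n≡m (toℕ<n i)) _ (toℕ<n i)) (fromℕ<-toℕ i _)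

  periodic²-ext : ∀ {a} {A : Set a} (f g : ℕ → ℕ → A) →
    (∀ y → Periodic n (λ x → f x y)) → (∀ x → Periodic n (f x)) →
    (∀ y → Periodic n (λ x → g x y)) → (∀ x → Periodic n (g x)) →
    (∀ (i j : Fin n) → f (toℕ i) (toℕ j) ≡ g (toℕ i) (toℕ j)) → ∀ x y → f x y ≡ g x y
  periodic²-ext f g fˣ fʸ gˣ gʸ f≗g x y = begin
    f x y                                   ≡⟨ toℕ-mod-invariant (fˣ y) x ⟨
    f (toℕ (x mod n)) y                     ≡⟨ toℕ-mod-invariant (fʸ _) y ⟨
    f (toℕ (x mod n)) (toℕ (y mod n))       ≡⟨ f≗g (x mod n) (y mod n) ⟩
    g (toℕ (x mod n)) (toℕ (y mod n))       ≡⟨ toℕ-mod-invariant (gʸ _) y ⟩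
    g (toℕ (x mod n)) y                     ≡⟨ toℕ-mod-invariant (gˣ y) x ⟩
    g x y                                   ∎

alternating-even : (f : ℕ → ℤ) → (∀ c → f (suc c) ≡ ℤ.- f c) → ∀ c → f (2 * c) ≡ f 0
alternating-even f step zero    = refl
alternating-even f step (suc c) = begin
  f (2 * suc c)         ≡⟨ cong f (*-suc 2 c) ⟩
  f (2 + 2 * c)         ≡⟨ step (1 + 2 * c) ⟩
  ℤ.- f (1 + 2 * c)     ≡⟨ cong ℤ.-_ (step (2 * c)) ⟩
  ℤ.- ℤ.- f (2 * c)     ≡⟨ neg-involutive (f (2 * c)) ⟩
  f (2 * c)             ≡⟨ alternating-even f step c ⟩
  f 0                   ∎

alternating-odd : (f : ℕ → ℤ) → (∀ c → f (suc c) ≡ ℤ.- f c) → ∀ c → f (1 + 2 * c) ≡ ℤ.- f 0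
alternating-odd f step c = trans (step (2 * c)) (cong ℤ.-_ (alternating-even f step c))

i≡-i⇒i≡0 : ∀ x → x ≡ ℤ.- x → x ≡ + 0
i≡-i⇒i≡0 (+ zero)  _  = refl
i≡-i⇒i≡0 (+ suc n) ()
i≡-i⇒i≡0 ℤ.-[1+ n ] ()

mixed-difference-zero⇒separable : (F : ℕ → ℕ → ℤ) →
  (∀ p q → F (suc p) (suc q) ℤ.+ F p q ≡ F (suc p) q ℤ.+ F p (suc q)) →
  ∀ p q → F p q ℤ.+ F 0 0 ≡ F p 0 ℤ.+ F 0 q
mixed-difference-zero⇒separable F mixed = separable
  where
  difference-constant : ∀ p q → F (suc p) q ℤ.- F p q ≡ F (suc p) 0 ℤ.- F p 0
  difference-constant p zero    = refl
  difference-constant p (suc q) = begin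
    F (suc p) (suc q) ℤ.- F p (suc q)                       ≡⟨ regroup (F (suc p) (suc q)) (F p (suc q)) (F p q) ⟩
    (F (suc p) (suc q) ℤ.+ F p q) ℤ.- (F p (suc q) ℤ.+ F p q) ≡⟨ cong (ℤ._- (F p (suc q) ℤ.+ F p q)) (mixed p q) ⟩
    (F (suc p) q ℤ.+ F p (suc q)) ℤ.- (F p (suc q) ℤ.+ F p q) ≡⟨ cancel (F (suc p) q) (F p (suc q)) (F p q) ⟩
    F (suc p) q ℤ.- F p q                                   ≡⟨ difference-constant p q ⟩
    F (suc p) 0 ℤ.- F p 0                                   ∎
    where
    regroup : ∀ u v w → u ℤ.- v ≡ (u ℤ.+ w) ℤ.- (v ℤ.+ w)
    regroup = ℤ-Solver.solve-∀
    cancel : ∀ a b c → (a ℤ.+ b) ℤ.- (b ℤ.+ c) ≡ a ℤ.- c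
    cancel = ℤ-Solver.solve-∀

  separable : ∀ p q → F p q ℤ.+ F 0 0 ≡ F p 0 ℤ.+ F 0 q
  separable zero    q = ℤ.+-comm (F 0 q) (F 0 0)
  separable (suc p) q = begin
    F (suc p) q ℤ.+ F 0 0                             ≡⟨ telescope (F (suc p) q) (F p q) (F 0 0) ⟩
    (F (suc p) q ℤ.- F p q) ℤ.+ (F p q ℤ.+ F 0 0)     ≡⟨ cong₂ ℤ._+_ (difference-constant p q) (separable p q) ⟩
    (F (suc p) 0 ℤ.- F p 0) ℤ.+ (F p 0 ℤ.+ F 0 q)     ≡⟨ telescope (F (suc p) 0) (F p 0) (F 0 q) ⟨
    F (suc p) 0 ℤ.+ F 0 q                             ∎
    where
    telescope : ∀ a b c → a ℤ.+ c ≡ (a ℤ.- b) ℤ.+ (b ℤ.+ c)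
    telescope = ℤ-Solver.solve-∀

[2t+1]-[1+t+d]≡t⊖d : ∀ t d → + (2 * t + 1) ℤ.- + (suc t + d) ≡ t ⊖ d
[2t+1]-[1+t+d]≡t⊖d t d = begin
  + (2 * t + 1) ℤ.- + (suc t + d)  ≡⟨ m-n≡m⊖n (2 * t + 1) (suc t + d) ⟩
  (2 * t + 1) ⊖ (suc t + d)        ≡⟨ cong (_⊖ (suc t + d)) (split t) ⟩
  ((1 + t) + t) ⊖ (suc t + d)      ≡⟨ +-cancelˡ-⊖ (suc t) t d ⟩
  t ⊖ d                            ∎
  where
  split : ∀ t → 2 * t + 1 ≡ (1 + t) + t
  split = ℕ-Solver.solve-∀

𝒩-neg : ∀ {N x} → Inℕ𝒩 N x → Inℕ𝒩 N (ℤ.- x)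
𝒩-neg {N} (i , refl) = opposite i , (begin
  ℤ.- (+ (2 * t + 1) ℤ.- + N)             ≡⟨ cong (λ n → ℤ.- (+ (2 * t + 1) ℤ.- + n)) N≡1+t+d ⟩
  ℤ.- (+ (2 * t + 1) ℤ.- + (suc t + d))   ≡⟨ cong ℤ.-_ ([2t+1]-[1+t+d]≡t⊖d t d) ⟩
  ℤ.- (t ⊖ d)                             ≡⟨ ⊖-swap d t ⟨
  d ⊖ t                                   ≡⟨ [2t+1]-[1+t+d]≡t⊖d d t ⟨
  + (2 * d + 1) ℤ.- + (suc d + t)         ≡⟨ cong₂ (λ e n → + (2 * e + 1) ℤ.- + n) (opposite-prop i) N≡1+d+t ⟨
  + (2 * toℕ (opposite i) + 1) ℤ.- + N    ∎)
  where
  t = toℕ i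
  d = N ∸ suc t
  N≡1+t+d : N ≡ suc t + d
  N≡1+t+d = sym (m+[n∸m]≡n (toℕ<n i))
  N≡1+d+t : N ≡ suc d + t
  N≡1+d+t = trans N≡1+t+d (cong suc (+-comm t d))

𝒩-lower : ∀ {N x} → Inℕ𝒩 N x → + 1 ℤ.- + N ℤ.≤ x
𝒩-lower {N} (i , refl) = ℤ.+-monoˡ-≤ (ℤ.- + N) (ℤ.+≤+ (m≤n+m 1 (2 * toℕ i)))

𝒩-upper : ∀ {N x} → Inℕ𝒩 N x → x ℤ.≤ + N ℤ.- + 1
𝒩-upper {N} {x} x∈𝒩 =
  subst₂ ℤ._≤_ (neg-involutive x) (flip (+ N)) (neg-mono-≤ (𝒩-lower (𝒩-neg x∈𝒩)))
  where
  flip : ∀ n → ℤ.- (+ 1 ℤ.- n) ≡ n ℤ.- + 1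
  flip = ℤ-Solver.solve-∀

𝒩-odd : ∀ {M x} → Inℕ𝒩 (2 * M) x → ∃ λ t → x ≡ + 1 ℤ.+ + 2 ℤ.* t
𝒩-odd {M} (i , refl) = + toℕ i ℤ.- + M , (begin
  + (2 * toℕ i + 1) ℤ.- + (2 * M)             ≡⟨ cong₂ ℤ._-_ (trans (pos-+ (2 * toℕ i) 1) (cong (ℤ._+ + 1) (pos-* 2 (toℕ i)))) (pos-* 2 M) ⟩
  (+ 2 ℤ.* + toℕ i ℤ.+ + 1) ℤ.- + 2 ℤ.* + M   ≡⟨ regroup (+ toℕ i) (+ M) ⟩
  + 1 ℤ.+ + 2 ℤ.* (+ toℕ i ℤ.- + M)           ∎)
  where
  regroup : ∀ t u → (+ 2 ℤ.* t ℤ.+ + 1) ℤ.- + 2 ℤ.* u ≡ + 1 ℤ.+ + 2 ℤ.* (t ℤ.- u)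
  regroup = ℤ-Solver.solve-∀

-- L is a labelling of C_m □ C_2m read on ℕ × ℕ; magic x y is the neighbour sum at
-- (1 + x, 1 + y), shifted so that no subtraction occurs.
record IsMagicArray (m : ℕ) (L : ℕ → ℕ → ℤ) : Set where
  field
    periodicˣ : ∀ y → Periodic m (λ x → L x y)
    periodicʸ : ∀ x → Periodic (2 * m) (L x)
    magic     : ∀ x y → L (2 + x) (1 + y) ℤ.+ L x (1 + y) ℤ.+ L (1 + x) (2 + y) ℤ.+ L (1 + x) y ≡ + 0

module MagicArray {k : ℕ} {L : ℕ → ℕ → ℤ} (isMagic : IsMagicArray (1 + 2 * k) L) where
  open IsMagicArray isMagic

  m : ℕ
  m = 1 + 2 * k

  L-shiftˣ : ∀ {x x′} c y → x ≡ x′ + c * m → L x y ≡ L x′ y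
  L-shiftˣ c y = periodic-shift (periodicˣ y) c

  L-shiftʸ : ∀ x {y y′} d → y ≡ y′ + d * (2 * m) → L x y ≡ L x y′
  L-shiftʸ x d = periodic-shift (periodicʸ x) d

  L-shift : ∀ {x x′ y y′} c d → x ≡ x′ + c * m → y ≡ y′ + d * (2 * m) → L x y ≡ L x′ y′
  L-shift {x′ = x′} {y = y} c d x≡ y≡ = trans (L-shiftˣ c y x≡) (L-shiftʸ x′ d y≡)

  diagonal : ℕ → ℕ → ℤ
  diagonal x y = L (1 + x) y ℤ.+ L x (1 + y)

  diagonal-step : ∀ x y → diagonal (1 + x) (1 + y) ≡ ℤ.- diagonal x y
  diagonal-step x y = inverseʳ-unique (diagonal x y) (diagonal (1 + x) (1 + y))
    (trans (regroup (L (1 + x) y) (L x (1 + y)) (L (2 + x) (1 + y)) (L (1 + x) (2 + y))) (magic x y))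
    where
    regroup : ∀ a b c d → (a ℤ.+ b) ℤ.+ (c ℤ.+ d) ≡ c ℤ.+ b ℤ.+ d ℤ.+ a
    regroup = ℤ-Solver.solve-∀

  diagonal-periodicˣ : ∀ y → Periodic m (λ x → diagonal x y)
  diagonal-periodicˣ y x = cong₂ ℤ._+_ (periodicˣ y (1 + x)) (periodicˣ (1 + y) x)

  diagonal-antiperiodicʸ : ∀ x y → diagonal x (y + m) ≡ ℤ.- diagonal x y
  diagonal-antiperiodicʸ x y = begin
    diagonal x (y + m)        ≡⟨ diagonal-periodicˣ (y + m) x ⟨
    diagonal (x + m) (y + m)  ≡⟨ cong₂ diagonal (+-comm x m) (+-comm y m) ⟩
    diagonal (m + x) (m + y)  ≡⟨ alternating-odd (λ c → diagonal (c + x) (c + y)) (λ c → diagonal-step (c + x) (c + y)) k ⟩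
    ℤ.- diagonal x y          ∎

  antipodalSum : ℕ → ℕ → ℤ
  antipodalSum x y = L x y ℤ.+ L x (y + m)

  antipodalSum-step : ∀ x y → antipodalSum (1 + x) y ≡ ℤ.- antipodalSum x (1 + y)
  antipodalSum-step x y = inverseʳ-unique (antipodalSum x (1 + y)) (antipodalSum (1 + x) y) (begin
    antipodalSum x (1 + y) ℤ.+ antipodalSum (1 + x) y  ≡⟨ regroup (L x (1 + y)) (L x (1 + (y + m))) (L (1 + x) y) (L (1 + x) (y + m)) ⟩
    diagonal x y ℤ.+ diagonal x (y + m)                ≡⟨ cong (ℤ._+_ (diagonal x y)) (diagonal-antiperiodicʸ x y) ⟩
    diagonal x y ℤ.+ ℤ.- diagonal x y                  ≡⟨ ℤ.+-inverseʳ (diagonal x y) ⟩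
    + 0                                                ∎)
    where
    regroup : ∀ a b c d → (a ℤ.+ b) ℤ.+ (c ℤ.+ d) ≡ (c ℤ.+ a) ℤ.+ (d ℤ.+ b)
    regroup = ℤ-Solver.solve-∀

  antipodalSum-shift : ∀ {x x′ y y′} c d → x ≡ x′ + c * m → y ≡ y′ + d * m → antipodalSum x y ≡ antipodalSum x′ y′
  antipodalSum-shift {x′ = x′} {y = y} c d x≡ y≡ =
    trans (periodic-shift (λ x → cong₂ ℤ._+_ (periodicˣ y x) (periodicˣ (y + m) x)) c x≡)
          (periodic-shift periodicʸ-m d y≡)
    where
    periodicʸ-m : Periodic m (antipodalSum x′)
    periodicʸ-m y = trans (cong (ℤ._+_ (L x′ (y + m))) (L-shiftʸ x′ 1 (twice y m))) (ℤ.+-comm (L x′ (y + m)) (L x′ y))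
      where
      twice : ∀ y n → y + n + n ≡ y + 1 * (2 * n)
      twice = ℕ-Solver.solve-∀

  antipodalSum-zero : ∀ x y → antipodalSum x y ≡ + 0
  antipodalSum-zero x y = i≡-i⇒i≡0 (antipodalSum x y) (begin
    antipodalSum x y     ≡⟨ antipodalSum-shift 1 (2 * k) (once m x) (times m (2 * k) y) ⟨
    walk m               ≡⟨ alternating-odd walk walk-step k ⟩
    ℤ.- antipodalSum x y ∎)
    where
    once : ∀ n x → n + x ≡ x + 1 * n
    once = ℕ-Solver.solve-∀
    times : ∀ n c y → n * c + y ≡ y + c * n
    times = ℕ-Solver.solve-∀
    walk : ℕ → ℤ
    walk c = antipodalSum (c + x) (c * (2 * k) + y)
    walk-step : ∀ c → walk (suc c) ≡ ℤ.- walk c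
    walk-step c = trans (antipodalSum-step (c + x) ((1 + c) * (2 * k) + y))
                        (cong ℤ.-_ (antipodalSum-shift 0 1 (sym (+-identityʳ (c + x))) (one-more k c y)))
      where
      one-more : ∀ k c y → 1 + ((1 + c) * (2 * k) + y) ≡ (c * (2 * k) + y) + 1 * (1 + 2 * k)
      one-more = ℕ-Solver.solve-∀

  antipodal : ∀ x y → L x (y + m) ≡ ℤ.- L x y
  antipodal x y = inverseʳ-unique (L x y) (L x (y + m)) (antipodalSum-zero x y)

  magic-centred : ∀ x y → L (1 + x) (1 + y) ℤ.+ L (2 * k + x) (1 + y) ℤ.+ L x (2 + y) ℤ.+ L x y ≡ + 0
  magic-centred x y = trans
    (cong₂ ℤ._+_ (cong₂ ℤ._+_ (cong₂ ℤ._+_ (sym (L-shiftˣ 1 (1 + y) (two k x))) refl)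
                              (sym (L-shiftˣ 1 (2 + y) (one k x))))
                 (sym (L-shiftˣ 1 y (one k x))))
    (magic (2 * k + x) y)
    where
    two : ∀ k x → 2 + (2 * k + x) ≡ (1 + x) + 1 * (1 + 2 * k)
    two = ℕ-Solver.solve-∀
    one : ∀ k x → 1 + (2 * k + x) ≡ x + 1 * (1 + 2 * k)
    one = ℕ-Solver.solve-∀

  -- The entry of re(L) at i = P + 2kQ, j = (k+1)(P+Q), which inverts
  -- P ≡ j + (k+1)i, Q ≡ j + ki (mod m).
  F : ℕ → ℕ → ℤ
  F P Q = L (P + 2 * k * Q) (2 * ((1 + k) * (P + Q)))

  F-mixed : ∀ P Q → F (1 + P) (1 + Q) ℤ.+ F P Q ≡ F (1 + P) Q ℤ.+ F P (1 + Q)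
  F-mixed P Q = begin
    F (1 + P) (1 + Q) ℤ.+ F P Q
      ≡⟨ cong₂ ℤ._+_ (L-shift 1 1 (sucPQˣ k P Q) (sucPQʸ k P Q)) refl ⟩
    L x (2 + y) ℤ.+ L x y
      ≡⟨ inverseʳ-unique (L (1 + x) (1 + y) ℤ.+ L (2 * k + x) (1 + y)) (L x (2 + y) ℤ.+ L x y)
           (trans (sym (ℤ.+-assoc (L (1 + x) (1 + y) ℤ.+ L (2 * k + x) (1 + y)) (L x (2 + y)) (L x y)))
                  (magic-centred x y)) ⟩
    ℤ.- (L (1 + x) (1 + y) ℤ.+ L (2 * k + x) (1 + y))
      ≡⟨ neg-distrib-+ (L (1 + x) (1 + y)) (L (2 * k + x) (1 + y)) ⟩
    ℤ.- L (1 + x) (1 + y) ℤ.+ ℤ.- L (2 * k + x) (1 + y)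
      ≡⟨ cong₂ ℤ._+_ (trans (cong (L (1 + x)) (sucPʸ k P Q)) (antipodal (1 + x) (1 + y)))
                     (trans (cong₂ L (sucQˣ k P Q) (sucQʸ k P Q)) (antipodal (2 * k + x) (1 + y))) ⟨
    F (1 + P) Q ℤ.+ F P (1 + Q)
      ∎
    where
    x = P + 2 * k * Q
    y = 2 * ((1 + k) * (P + Q))
    sucPQˣ : ∀ k P Q → (1 + P) + 2 * k * (1 + Q) ≡ (P + 2 * k * Q) + 1 * (1 + 2 * k)
    sucPQˣ = ℕ-Solver.solve-∀
    sucPQʸ : ∀ k P Q → 2 * ((1 + k) * ((1 + P) + (1 + Q))) ≡ (2 + 2 * ((1 + k) * (P + Q))) + 1 * (2 * (1 + 2 * k))
    sucPQʸ = ℕ-Solver.solve-∀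
    sucPʸ : ∀ k P Q → 2 * ((1 + k) * ((1 + P) + Q)) ≡ (1 + 2 * ((1 + k) * (P + Q))) + (1 + 2 * k)
    sucPʸ = ℕ-Solver.solve-∀
    sucQˣ : ∀ k P Q → P + 2 * k * (1 + Q) ≡ 2 * k + (P + 2 * k * Q)
    sucQˣ = ℕ-Solver.solve-∀
    sucQʸ : ∀ k P Q → 2 * ((1 + k) * (P + (1 + Q))) ≡ (1 + 2 * ((1 + k) * (P + Q))) + (1 + 2 * k)
    sucQʸ = ℕ-Solver.solve-∀

  F-separable : ∀ P Q → F P Q ℤ.+ F 0 0 ≡ F P 0 ℤ.+ F 0 Q
  F-separable = mixed-difference-zero⇒separable F F-mixed

  F-periodicˡ : ∀ Q → Periodic m (λ P → F P Q)
  F-periodicˡ Q P = L-shift 1 (1 + k) (shiftˣ k P Q) (shiftʸ k P Q)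
    where
    shiftˣ : ∀ k P Q → P + (1 + 2 * k) + 2 * k * Q ≡ (P + 2 * k * Q) + 1 * (1 + 2 * k)
    shiftˣ = ℕ-Solver.solve-∀
    shiftʸ : ∀ k P Q → 2 * ((1 + k) * (P + (1 + 2 * k) + Q)) ≡ 2 * ((1 + k) * (P + Q)) + (1 + k) * (2 * (1 + 2 * k))
    shiftʸ = ℕ-Solver.solve-∀

  F-periodicʳ : ∀ P → Periodic m (F P)
  F-periodicʳ P Q = L-shift (2 * k) (1 + k) (shiftˣ k P Q) (shiftʸ k P Q)
    where
    shiftˣ : ∀ k P Q → P + 2 * k * (Q + (1 + 2 * k)) ≡ (P + 2 * k * Q) + 2 * k * (1 + 2 * k)
    shiftˣ = ℕ-Solver.solve-∀
    shiftʸ : ∀ k P Q → 2 * ((1 + k) * (P + (Q + (1 + 2 * k)))) ≡ 2 * ((1 + k) * (P + Q)) + (1 + k) * (2 * (1 + 2 * k))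
    shiftʸ = ℕ-Solver.solve-∀

  L-even-as-F : ∀ x y → L x (2 * y) ≡ F (y + (1 + k) * x) (y + k * x)
  L-even-as-F x y = sym (L-shift (y + k * x) (y + (1 + k) * x) (coordinateˣ k x y) (coordinateʸ k x y))
    where
    coordinateˣ : ∀ k x y → (y + (1 + k) * x) + 2 * k * (y + k * x) ≡ x + (y + k * x) * (1 + 2 * k)
    coordinateˣ = ℕ-Solver.solve-∀
    coordinateʸ : ∀ k x y → 2 * ((1 + k) * ((y + (1 + k) * x) + (y + k * x))) ≡ 2 * y + (y + (1 + k) * x) * (2 * (1 + 2 * k))
    coordinateʸ = ℕ-Solver.solve-∀

even-or-odd : ∀ n → ∃ λ h → n ≡ 2 * h ⊎ n ≡ 1 + 2 * h
even-or-odd zero = 0 , inj₁ refl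
even-or-odd (suc n) with even-or-odd n
... | h , inj₁ refl = h , inj₂ refl
... | h , inj₂ refl = suc h , inj₁ (sym (*-suc 2 h))

half-double : ∀ n → 2 * n / 2 ≡ n
half-double n = trans (cong (_/ 2) (ℕ.*-comm 2 n)) (m*n/n≡m n 2)

module DistanceMagicTable (k : ℕ) (ℓ : Labeling (1 + 2 * k))
  (zero-sums : ∀ i j → nbrSum (1 + 2 * k) ℓ i j ≡ + 0) (ℓ₀₀ : ℓ (ι₁ (1 + 2 * k) 0) (ι₂ (1 + 2 * k) 0) ≡ + 1) where

  m : ℕ
  m = 1 + 2 * k

  L : ℕ → ℕ → ℤ
  L x y = ℓ (ι₁ m x) (ι₂ m y)

  L-periodicˣ : ∀ y → Periodic m (λ x → L x y)
  L-periodicˣ y x = cong (λ i → ℓ i (ι₂ m y)) (mod-periodic m x)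

  L-periodicʸ : ∀ x → Periodic (2 * m) (L x)
  L-periodicʸ x y = cong (ℓ (ι₁ m x)) (mod-periodic (2 * m) y)

  nbrSum-as-L : ∀ x y → nbrSum m ℓ (ι₁ m (1 + x)) (ι₂ m (1 + y))
                          ≡ L (2 + x) (1 + y) ℤ.+ L x (1 + y) ℤ.+ L (1 + x) (2 + y) ℤ.+ L (1 + x) y
  nbrSum-as-L x y = cong₂ ℤ._+_ (cong₂ ℤ._+_ (cong₂ ℤ._+_ right left) up) down
    where
    right : L (suc (toℕ (ι₁ m (1 + x)))) (1 + y) ≡ L (2 + x) (1 + y)
    right = toℕ-mod-invariant m (λ t → L-periodicˣ (1 + y) (suc t)) (1 + x)
    left : L (toℕ (ι₁ m (1 + x)) + 2 * k) (1 + y) ≡ L x (1 + y)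
    left = trans (toℕ-mod-invariant m (λ t → periodic-shift (L-periodicˣ (1 + y)) 1 (commute k t)) (1 + x))
                 (periodic-shift (L-periodicˣ (1 + y)) 1 (wrap k x))
      where
      commute : ∀ k t → t + (1 + 2 * k) + 2 * k ≡ (t + 2 * k) + 1 * (1 + 2 * k)
      commute = ℕ-Solver.solve-∀
      wrap : ∀ k x → (1 + x) + 2 * k ≡ x + 1 * (1 + 2 * k)
      wrap = ℕ-Solver.solve-∀
    up : L (1 + x) (suc (toℕ (ι₂ m (1 + y)))) ≡ L (1 + x) (2 + y)
    up = toℕ-mod-invariant (2 * m) (λ t → L-periodicʸ (1 + x) (suc t)) (1 + y)
    down : L (1 + x) (toℕ (ι₂ m (1 + y)) + (2 * m ∸ 1)) ≡ L (1 + x) y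
    -- 2 * m ∸ 1 reduces to 2 * k + 1 * (1 + 2 * k).
    down = trans (toℕ-mod-invariant (2 * m) (λ t → periodic-shift (L-periodicʸ (1 + x)) 1 (commute k t)) (1 + y))
                 (periodic-shift (L-periodicʸ (1 + x)) 1 (wrap k y))
      where
      commute : ∀ k t → t + 2 * (1 + 2 * k) + (2 * k + 1 * (1 + 2 * k)) ≡ (t + (2 * k + 1 * (1 + 2 * k))) + 1 * (2 * (1 + 2 * k))
      commute = ℕ-Solver.solve-∀
      wrap : ∀ k y → (1 + y) + (2 * k + 1 * (1 + 2 * k)) ≡ y + 1 * (2 * (1 + 2 * k))
      wrap = ℕ-Solver.solve-∀

  L-isMagic : IsMagicArray m L
  L-isMagic = record
    { periodicˣ = L-periodicˣ
    ; periodicʸ = L-periodicʸ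
    ; magic     = λ x y → trans (sym (nbrSum-as-L x y)) (zero-sums (ι₁ m (1 + x)) (ι₂ m (1 + y)))
    }

  open MagicArray {k} L-isMagic using (L-shiftʸ; antipodal; F; F-separable; F-periodicˡ; F-periodicʳ; L-even-as-F)

  seq-periodic : (s : Seq m) → Periodic m (λ z → s (ι₁ m z))
  seq-periodic s z = cong s (mod-periodic m z)

  a : Seq m
  a p = F (toℕ p) 0

  b : Seq m
  b q = F 0 (toℕ q) ℤ.- + 1

  F₀₀ : F 0 0 ≡ + 1
  F₀₀ = trans (cong₂ L (ℕ.*-zeroʳ (2 * k)) (cong (2 *_) (ℕ.*-zeroʳ (1 + k)))) ℓ₀₀

  F-as-ab : ∀ P Q → F P Q ≡ a (ι₁ m P) ℤ.+ b (ι₁ m Q)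
  F-as-ab P Q = begin
    F P Q                                ≡⟨ cancel (F P Q) (F 0 0) ⟩
    F P Q ℤ.+ (F 0 0 ℤ.- F 0 0)          ≡⟨ cong (λ v → F P Q ℤ.+ (F 0 0 ℤ.- v)) F₀₀ ⟩
    F P Q ℤ.+ (F 0 0 ℤ.- + 1)            ≡⟨ ℤ.+-assoc (F P Q) (F 0 0) (ℤ.- + 1) ⟨
    (F P Q ℤ.+ F 0 0) ℤ.- + 1            ≡⟨ cong (ℤ._- + 1) (F-separable P Q) ⟩
    (F P 0 ℤ.+ F 0 Q) ℤ.- + 1            ≡⟨ ℤ.+-assoc (F P 0) (F 0 Q) (ℤ.- + 1) ⟩
    F P 0 ℤ.+ (F 0 Q ℤ.- + 1)            ≡⟨ cong₂ ℤ._+_ (toℕ-mod-invariant m (F-periodicˡ 0) P)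
                                                        (cong (ℤ._- + 1) (toℕ-mod-invariant m (F-periodicʳ 0) Q)) ⟨
    a (ι₁ m P) ℤ.+ b (ι₁ m Q)            ∎
    where
    cancel : ∀ u v → u ≡ u ℤ.+ (v ℤ.- v)
    cancel = ℤ-Solver.solve-∀

  -- Since −k ≡ k+1 and −(k+1) ≡ k (mod m), the entry (i, j) of 𝒯(a,(m−1)/2) ⊞ 𝒯(b,(m+1)/2)
  -- is a (j + (k+1)i) + b (j + ki).
  RepresentsOnℕ : Seq m → Seq m → Set
  RepresentsOnℕ a′ b′ = ∀ x y → L x (2 * y) ≡ a′ (ι₁ m (y + (1 + k) * x)) ℤ.+ b′ (ι₁ m (y + k * x))

  𝒯-entry : ∀ (s : Seq m) d c i j → d + c ≡ m → 𝒯 m s d i j ≡ s (ι₁ m (toℕ j + c * toℕ i))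
  𝒯-entry s d c i j d+c≡m = cong (λ z → s (ι₁ m z)) (begin
    (toℕ j + m * toℕ i) ∸ d * toℕ i              ≡⟨ cong (λ n → (toℕ j + n * toℕ i) ∸ d * toℕ i) d+c≡m ⟨
    (toℕ j + (d + c) * toℕ i) ∸ d * toℕ i        ≡⟨ cong (_∸ d * toℕ i) (split (toℕ j) d c (toℕ i)) ⟩
    (toℕ j + c * toℕ i) + d * toℕ i ∸ d * toℕ i  ≡⟨ m+n∸n≡m (toℕ j + c * toℕ i) (d * toℕ i) ⟩
    toℕ j + c * toℕ i                            ∎)
    where
    split : ∀ J d c I → J + (d + c) * I ≡ (J + c * I) + d * I
    split = ℕ-Solver.solve-∀

  ⊞-entry : ∀ a′ b′ i j → (_⊞_ m (𝒯 m a′ ((m ∸ 1) / 2)) (𝒯 m b′ ((m + 1) / 2))) i j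
                                    ≡ a′ (ι₁ m (toℕ j + (1 + k) * toℕ i)) ℤ.+ b′ (ι₁ m (toℕ j + k * toℕ i))
  ⊞-entry a′ b′ i j =
    cong₂ ℤ._+_ (𝒯-entry a′ _ (1 + k) i j (trans (cong (_+ (1 + k)) (half-double k)) (halves k)))
                (𝒯-entry b′ _ k i j (trans (cong (_+ k) (trans (cong (_/ 2) (succ k)) (half-double (1 + k)))) (halves′ k)))
    where
    halves : ∀ k → k + (1 + k) ≡ 1 + 2 * k
    halves = ℕ-Solver.solve-∀
    halves′ : ∀ k → (1 + k) + k ≡ 1 + 2 * k
    halves′ = ℕ-Solver.solve-∀
    succ : ∀ k → (1 + 2 * k) + 1 ≡ 2 * (1 + k)
    succ = ℕ-Solver.solve-∀

  re-as-L : ∀ i j → re m ℓ i j ≡ L (toℕ i) (2 * toℕ j)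
  re-as-L i j = cong (λ i′ → ℓ i′ (ι₂ m (2 * toℕ j))) (sym (mod-toℕ m i))

  onℕ⇒represents : ∀ a′ b′ → RepresentsOnℕ a′ b′ → Represents m ℓ a′ b′
  onℕ⇒represents a′ b′ R i j =
    trans (re-as-L i j) (trans (R (toℕ i) (toℕ j)) (sym (⊞-entry a′ b′ i j)))

  represents⇒onℕ : ∀ a′ b′ → Represents m ℓ a′ b′ → RepresentsOnℕ a′ b′
  represents⇒onℕ a′ b′ R = periodic²-ext m (λ x y → L x (2 * y)) rhs
    (λ y → L-periodicˣ (2 * y))
    (λ x y → L-shiftʸ x 1 (double y m))
    (λ y x → cong₂ ℤ._+_ (periodic-shift (seq-periodic a′) (1 + k) (shift y (1 + k) x m))
                         (periodic-shift (seq-periodic b′) k (shift y k x m)))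
    (λ x y → cong₂ ℤ._+_ (periodic-shift (seq-periodic a′) 1 (commute y (1 + k) x m))
                         (periodic-shift (seq-periodic b′) 1 (commute y k x m)))
    (λ i j → trans (sym (re-as-L i j)) (trans (R i j) (⊞-entry a′ b′ i j)))
    where
    rhs : ℕ → ℕ → ℤ
    rhs x y = a′ (ι₁ m (y + (1 + k) * x)) ℤ.+ b′ (ι₁ m (y + k * x))
    double : ∀ y n → 2 * (y + n) ≡ 2 * y + 1 * (2 * n)
    double = ℕ-Solver.solve-∀
    shift : ∀ y c x n → y + c * (x + n) ≡ (y + c * x) + c * n
    shift = ℕ-Solver.solve-∀
    commute : ∀ y c x n → (y + n) + c * x ≡ (y + c * x) + 1 * n
    commute = ℕ-Solver.solve-∀

  onℕ⇒F : ∀ a′ b′ → RepresentsOnℕ a′ b′ → ∀ P Q → F P Q ≡ a′ (ι₁ m P) ℤ.+ b′ (ι₁ m Q)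
  onℕ⇒F a′ b′ R P Q = trans (R (P + 2 * k * Q) ((1 + k) * (P + Q)))
    (cong₂ ℤ._+_ (periodic-shift (seq-periodic a′) (P + (1 + k) * Q) (inverseˣ k P Q))
                 (periodic-shift (seq-periodic b′) (P + k * Q) (inverseʸ k P Q)))
    where
    inverseˣ : ∀ k P Q → (1 + k) * (P + Q) + (1 + k) * (P + 2 * k * Q) ≡ P + (P + (1 + k) * Q) * (1 + 2 * k)
    inverseˣ = ℕ-Solver.solve-∀
    inverseʸ : ∀ k P Q → (1 + k) * (P + Q) + k * (P + 2 * k * Q) ≡ Q + (P + k * Q) * (1 + 2 * k)
    inverseʸ = ℕ-Solver.solve-∀

  representsOnℕ : RepresentsOnℕ a b
  representsOnℕ x y = trans (L-even-as-F x y) (F-as-ab (y + (1 + k) * x) (y + k * x))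

  represents : Represents m ℓ a b
  represents = onℕ⇒represents a b representsOnℕ

  unique : ∀ a′ b′ → Admissible m a′ b′ → Represents m ℓ a′ b′ → (∀ p → a′ p ≡ a p) × (∀ q → b′ q ≡ b q)
  unique a′ b′ (_ , _ , a′₀ , b′₀ , _) R = a′≡a , b′≡b
    where
    F≡a′+b′ = onℕ⇒F a′ b′ (represents⇒onℕ a′ b′ R)
    a′≡a : ∀ p → a′ p ≡ a p
    a′≡a p = begin
      a′ p                                   ≡⟨ cong a′ (mod-toℕ m p) ⟨
      a′ (ι₁ m (toℕ p))                      ≡⟨ ℤ.+-identityʳ _ ⟨
      a′ (ι₁ m (toℕ p)) ℤ.+ + 0              ≡⟨ cong (ℤ._+_ (a′ (ι₁ m (toℕ p)))) b′₀ ⟨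
      a′ (ι₁ m (toℕ p)) ℤ.+ b′ (ι₁ m 0)      ≡⟨ F≡a′+b′ (toℕ p) 0 ⟨
      a p                                    ∎
    b′≡b : ∀ q → b′ q ≡ b q
    b′≡b q = begin
      b′ q                                   ≡⟨ cong b′ (mod-toℕ m q) ⟨
      b′ (ι₁ m (toℕ q))                      ≡⟨ cancel (b′ (ι₁ m (toℕ q))) ⟩
      (+ 1 ℤ.+ b′ (ι₁ m (toℕ q))) ℤ.- + 1    ≡⟨ cong (λ u → (u ℤ.+ b′ (ι₁ m (toℕ q))) ℤ.- + 1) a′₀ ⟨
      (a′ (ι₁ m 0) ℤ.+ b′ (ι₁ m (toℕ q))) ℤ.- + 1  ≡⟨ cong (ℤ._- + 1) (F≡a′+b′ 0 (toℕ q)) ⟨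
      b q                                    ∎
      where
      cancel : ∀ u → u ≡ (+ 1 ℤ.+ u) ℤ.- + 1
      cancel = ℤ-Solver.solve-∀

  ℓ-as-L : ∀ i j → ℓ i j ≡ L (toℕ i) (toℕ j)
  ℓ-as-L i j = sym (cong₂ ℓ (mod-toℕ m i) (mod-toℕ (2 * m) j))

  L-signed-even : ∀ x y → ∃ λ h → L x y ≡ L x (2 * h) ⊎ L x y ≡ ℤ.- L x (2 * h)
  L-signed-even x y with even-or-odd y
  ... | h , inj₁ refl = h , inj₁ refl
  ... | h , inj₂ refl = 1 + k + h , inj₂ (begin
    L x (1 + 2 * h)                   ≡⟨ neg-involutive (L x (1 + 2 * h)) ⟨
    ℤ.- ℤ.- L x (1 + 2 * h)           ≡⟨ cong ℤ.-_ (antipodal x (1 + 2 * h)) ⟨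
    ℤ.- L x (1 + 2 * h + m)           ≡⟨ cong (λ z → ℤ.- L x z) (across k h) ⟩
    ℤ.- L x (2 * (1 + k + h))         ∎)
    where
    across : ∀ k h → 1 + 2 * h + (1 + 2 * k) ≡ 2 * (1 + k + h)
    across = ℕ-Solver.solve-∀

  ab-as-F : ∀ i j → a i ℤ.+ b j ≡ F (toℕ i) (toℕ j)
  ab-as-F i j = sym (trans (F-as-ab (toℕ i) (toℕ j)) (cong₂ (λ p q → a p ℤ.+ b q) (mod-toℕ m i) (mod-toℕ m j)))

  N : ℕ
  N = 2 * m * m

  Ord≡N : Ord m ≡ N
  Ord≡N = ℕ.*-comm m (2 * m)

  SignedSum : ℤ → Set
  SignedSum y = Σ ℤ λ s → (s ≡ + 1 ⊎ s ≡ ℤ.- + 1) × Σ (Fin m) λ i → Σ (Fin m) λ j → y ≡ s ℤ.* (a i ℤ.+ b j)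

  module _ (in𝒩 : ∀ i j → Inℕ𝒩 (Ord m) (ℓ i j)) where

    F-in-𝒩 : ∀ P Q → Inℕ𝒩 N (F P Q)
    F-in-𝒩 P Q = subst (λ n → Inℕ𝒩 n (F P Q)) Ord≡N (in𝒩 _ _)

    F-odd : ∀ P Q → ∃ λ t → F P Q ≡ + 1 ℤ.+ + 2 ℤ.* t
    F-odd P Q = 𝒩-odd {m * m} (subst (λ n → Inℕ𝒩 n (F P Q)) (ℕ.*-assoc 2 m m) (F-in-𝒩 P Q))

    a-odd-bounded : ∀ p → (∃ λ t → a p ≡ + 1 ℤ.+ + 2 ℤ.* t) × (+ 1 ℤ.- + N ℤ.≤ a p) × (a p ℤ.≤ + N ℤ.- + 1)
    a-odd-bounded p = F-odd (toℕ p) 0 , 𝒩-lower (F-in-𝒩 (toℕ p) 0) , 𝒩-upper (F-in-𝒩 (toℕ p) 0)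

    b-even-bounded : ∀ q → (∃ λ t → b q ≡ + 2 ℤ.* t) × (ℤ.- + N ℤ.≤ b q) × (b q ℤ.≤ + N ℤ.- + 2)
    b-even-bounded q = even (F-odd 0 (toℕ q)) , lower , upper
      where
      even : (∃ λ t → F 0 (toℕ q) ≡ + 1 ℤ.+ + 2 ℤ.* t) → ∃ λ t → b q ≡ + 2 ℤ.* t
      even (t , e) = t , trans (cong (ℤ._- + 1) e) (drop t)
        where
        drop : ∀ t → (+ 1 ℤ.+ + 2 ℤ.* t) ℤ.- + 1 ≡ + 2 ℤ.* t
        drop = ℤ-Solver.solve-∀
      lower : ℤ.- + N ℤ.≤ b q
      lower = subst (ℤ._≤ b q) (below (+ N)) (ℤ.+-monoˡ-≤ (ℤ.- + 1) (𝒩-lower (F-in-𝒩 0 (toℕ q))))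
        where
        below : ∀ n → (+ 1 ℤ.- n) ℤ.- + 1 ≡ ℤ.- n
        below = ℤ-Solver.solve-∀
      upper : b q ℤ.≤ + N ℤ.- + 2
      upper = subst (b q ℤ.≤_) (above (+ N)) (ℤ.+-monoˡ-≤ (ℤ.- + 1) (𝒩-upper (F-in-𝒩 0 (toℕ q))))
        where
        above : ∀ n → (n ℤ.- + 1) ℤ.- + 1 ≡ n ℤ.- + 2
        above = ℤ-Solver.solve-∀

    signed-sums-in-𝒩 : ∀ y → SignedSum y → Inℕ𝒩 N y
    signed-sums-in-𝒩 _ (_ , inj₁ refl , i , j , refl) =
      subst (Inℕ𝒩 N) (sym (trans (ℤ.*-identityˡ _) (ab-as-F i j))) (F-in-𝒩 (toℕ i) (toℕ j))
    signed-sums-in-𝒩 _ (_ , inj₂ refl , i , j , refl) =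
      subst (Inℕ𝒩 N) (sym (trans (ℤ.-1*i≡-i _) (cong ℤ.-_ (ab-as-F i j)))) (𝒩-neg (F-in-𝒩 (toℕ i) (toℕ j)))

  𝒩-signed-sums : (∀ x → Inℕ𝒩 (Ord m) x → Σ (Fin m) λ i → Σ (Fin (2 * m)) λ j → ℓ i j ≡ x) →
                  ∀ y → Inℕ𝒩 N y → SignedSum y
  𝒩-signed-sums onto y y∈𝒩 with onto y (subst (λ n → Inℕ𝒩 n y) (sym Ord≡N) y∈𝒩)
  ... | i , j , refl with L-signed-even (toℕ i) (toℕ j)
  ... | h , inj₁ e = + 1 , inj₁ refl , ι₁ m (h + (1 + k) * toℕ i) , ι₁ m (h + k * toℕ i) ,
        trans (ℓ-as-L i j) (trans e (trans (representsOnℕ (toℕ i) h) (sym (ℤ.*-identityˡ _))))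
  ... | h , inj₂ e = ℤ.- + 1 , inj₂ refl , ι₁ m (h + (1 + k) * toℕ i) , ι₁ m (h + k * toℕ i) ,
        trans (ℓ-as-L i j) (trans e (trans (cong ℤ.-_ (representsOnℕ (toℕ i) h)) (sym (ℤ.-1*i≡-i _))))

  admissible : IsDistanceMagic m ℓ → Admissible m a b
  admissible (in𝒩 , _ , onto , _) =
    a-odd-bounded in𝒩 , b-even-bounded in𝒩 , F₀₀ , cong (ℤ._- + 1) F₀₀ , signed-sums-in-𝒩 in𝒩 , 𝒩-signed-sums onto

theorem3p5 : (m : ℕ) → .{{_ : NonZero m}} → 3 ≤ m → OddN m →
    (ℓ : Labeling m) → IsDistanceMagic m ℓ → ℓ (ι₁ m 0) (ι₂ m 0) ≡ + 1 →
    Σ (Seq m) (λ a → Σ (Seq m) (λ b → (Admissible m a b × Represents m ℓ a b)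
      × ((a′ b′ : Seq m) → Admissible m a′ b′ → Represents m ℓ a′ b′ →
          ((∀ i → a′ i ≡ a i) × (∀ i → b′ i ≡ b i)))))
theorem3p5 m _ (k , refl) ℓ magic@(_ , _ , _ , zero-sums) ℓ₀₀ =
  a , b , (admissible magic , represents) , unique
  where open DistanceMagicTable k ℓ zero-sums ℓ₀₀
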